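{- Let $k \geq 1$ be an integer and let $G$ be a connected graph of order $n \geq 2$. Then $\gamma_{k}^t(G) \geq \frac{\mathrm{diam}(G)+1}{2k}$.
   Context: All graphs are finite and simple; $d_G(u,v)$ is the length of a shortest $(u,v)$-path in $G$, and for $S \subseteq V(G)$, $d_G(v,S)=\min_{w\in S} d_G(v,w)$. $\mathrm{diam}(G)$ is the maximum of $d_G(u,v)$ over all pairs of vertices. For an integer $k\ge 1$ and a graph $G$ without isolated vertices, a set $S\subseteq V(G)$ is a total $k$-dominating set of $G$ if $d_G(v, S\setminus\{v\}) \le k$ for every $v \in V(G)$; the total $k$-domination number $\gamma_k^t(G)$ is the minimum cardinality of such a set. -}

module Defs where

open import Data.Nat using (ℕ; zero; suc; _+_; _≤_)
open import Data.Fin using (Fin)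
open import Data.Fin.Subset using (Subset; _∈_; ∣_∣)
open import Data.Product using (Σ; ∃; _×_; _,_)
open import Relation.Nullary using (¬_; Dec)
open import Relation.Binary.PropositionalEquality using (_≡_; _≢_)

record Graph (n : ℕ) : Set₁ where
  field
    Adj   : Fin n → Fin n → Set
    adj?  : ∀ u v → Dec (Adj u v)
    sym   : ∀ {u v} → Adj u v → Adj v u
    irrefl : ∀ {u} → ¬ Adj u u
open Graph public

data Walk {n : ℕ} (G : Graph n) : Fin n → Fin n → ℕ → Set where
  here : ∀ {u} → Walk G u u zero
  step : ∀ {u w v ℓ} → Adj G u w → Walk G w v ℓ → Walk G u v (suc ℓ)

Connected : ∀ {n} → Graph n → Set
Connected G = ∀ u v → ∃ λ ℓ → Walk G u v ℓ

IsDist : ∀ {n} → Graph n → Fin n → Fin n → ℕ → Set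
IsDist G u v d = Walk G u v d × (∀ ℓ → Walk G u v ℓ → d ≤ ℓ)

IsDiam : ∀ {n} → Graph n → ℕ → Set
IsDiam {n} G D =
  (Σ (Fin n) λ u → Σ (Fin n) λ v → IsDist G u v D)
  × (∀ u v d → IsDist G u v d → d ≤ D)

-- d_G(v, S \ {v}) ≤ k : some w ∈ S with w ≠ v is reachable from v by a walk of length ≤ k.
WithinDist : ∀ {n} → Graph n → ℕ → Fin n → Subset n → Set
WithinDist {n} G k v S =
  Σ (Fin n) λ w → (w ∈ S) × (w ≢ v) × (∃ λ ℓ → (ℓ ≤ k) × Walk G v w ℓ)

IsTotalKDom : ∀ {n} → Graph n → ℕ → Subset n → Set
IsTotalKDom G k S = ∀ v → WithinDist G k v S

IsTotalKDomNumber : ∀ {n} → Graph n → ℕ → ℕ → Set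
IsTotalKDomNumber {n} G k γ =
  (Σ (Subset n) λ S → IsTotalKDom G k S × (∣ S ∣ ≡ γ))
  × (∀ S → IsTotalKDom G k S → γ ≤ ∣ S ∣)

-- Let u, v be the ends of a diametral path and label every vertex s by its
-- level f s = d(u, s).  Every level 0, …, D lies within k of the level of some
-- vertex of a total k-dominating set S (dominate the path vertex on that level),
-- and every vertex of S has another one of S whose level is within k of its own.
-- Such a set of levels covers at most 2k|S| consecutive integers: remove the
-- highest vertex x of S, and if the next highest y is then left without a
-- partner remove y as well; x costs at most k covered levels and the pair
-- {x, y} at most 4k.

module Submission where

open import Defs
open import Data.Nat using (ℕ; zero; suc; _+_; _*_; _∸_; _⊓_; _≤_; _<_; _≤?_; z≤n; s≤s; s≤s⁻¹)
open import Data.Nat.Properties hiding (_≟_)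
open import Data.Nat.Induction using (<-rec)
open import Data.Nat.Tactic.RingSolver using (solve-∀)
open import Data.Fin using (Fin; zero; suc; toℕ; fromℕ<; _≟_)
import Data.Fin.Properties as Fin
open import Data.Fin.Subset using (Subset; _∈_; _∉_; _⊂_; ∣_∣; _-_; inside; outside)
open import Data.Fin.Subset.Properties
  using (_∈?_; p─q⊆p; x∈p∧x≢y⇒x∈p-y; x∈p⇒p-x⊂p; x∈p⇒∣p-x∣<∣p∣; ⊂-trans)
open import Data.Fin.Subset.Induction using (Acc; acc; ⊂-wellFounded)
open import Data.Product using (∃; _×_; _,_; proj₁; proj₂; swap)
open import Data.Sum using (_⊎_; inj₁; inj₂)
open import Data.Vec using (_∷_; there)
open import Function using (_∘_; case_of_)
open import Level using (Level)
open import Relation.Nullary using (¬_; Dec; yes; no; contradiction)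
open import Relation.Nullary.Decidable using (map′; _×-dec_)
open import Relation.Unary using (Pred; Decidable)
open import Relation.Binary.PropositionalEquality as ≡ using (_≡_; _≢_; refl; cong; subst)

private
  variable
    ℓ : Level

IsLeast : Pred ℕ ℓ → ℕ → Set ℓ
IsLeast P d = P d × (∀ l → P l → d ≤ l)

least : {P : Pred ℕ ℓ} → Decidable P → ∀ {m} → P m → ∃ (IsLeast P)
least {P = P} P? {m} = <-rec (λ m → P m → ∃ (IsLeast P)) search m
  where
  search : ∀ m → (∀ {l} → l < m → P l → ∃ (IsLeast P)) → P m → ∃ (IsLeast P)
  search m below pm with Fin.any? (λ (i : Fin m) → P? (toℕ i))
  ... | yes (i , pi) = below (Fin.toℕ<n i) pi
  ... | no none = m , pm , λ l pl →
          ≮⇒≥ (λ l<m → none (fromℕ< l<m , subst P (≡.sym (Fin.toℕ-fromℕ< l<m)) pl))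

argmax : ∀ {m} (f : Fin m → ℕ) {P : Pred (Fin m) ℓ} → Decidable P → ∃ P →
         ∃ λ x → P x × (∀ {z} → P z → f z ≤ f x)
argmax {m = suc m} f {P} P? w with Fin.any? (P? ∘ suc)
... | no none =
  zero ,
  (case w of λ { (zero , p) → p ; (suc z , p) → contradiction (z , p) none }) ,
  λ { {zero} _ → ≤-refl ; {suc z} pz → contradiction (z , pz) none }
... | yes w′ with argmax (f ∘ suc) (P? ∘ suc) w′
...   | x , px , x-max with P? zero ×-dec (f (suc x) ≤? f zero)
...     | yes (p0 , fx≤f0) =
  zero , p0 , λ { {zero} _ → ≤-refl ; {suc z} pz → ≤-trans (x-max pz) fx≤f0 }
...     | no ¬zero-wins =
  suc x , px , λ { {zero} p0 → <⇒≤ (≰⇒> (λ fx≤f0 → ¬zero-wins (p0 , fx≤f0)))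
                 ; {suc z} pz → x-max pz }

m≤n+o⇒m≤m⊓n+o : ∀ {m} n o → m ≤ n + o → m ≤ m ⊓ n + o
m≤n+o⇒m≤m⊓n+o {m} n o m≤n+o =
  subst (m ≤_) (≡.sym (+-distribʳ-⊓ o m n)) (⊓-glb (m≤m+n m o) m≤n+o)

m<n∸o⇒m+o<n : ∀ {m n o} → m < n ∸ o → m + o < n
m<n∸o⇒m+o<n {m} m<n∸o = m≤o∸n⇒m+n≤o (suc m) (<⇒≤ (m∸n≢0⇒n<m (m<n⇒n≢0 m<n∸o))) m<n∸o

m<n⇒o*m+o≤o*n : ∀ o {m n} → m < n → o * m + o ≤ o * n
m<n⇒o*m+o≤o*n o {m} {n} m<n = begin
  o * m + o  ≡⟨ +-comm (o * m) o ⟩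
  o + o * m  ≡⟨ *-suc o m ⟨
  o * suc m  ≤⟨ *-monoʳ-≤ o m<n ⟩
  o * n      ∎
  where open ≤-Reasoning

1+[m+n]+n≤m∸n+[2n+2n] : ∀ {n} → 1 ≤ n → ∀ m → suc (m + n) + n ≤ m ∸ n + (2 * n + 2 * n)
1+[m+n]+n≤m∸n+[2n+2n] {n} 1≤n m = begin
  suc (m + n) + n            ≤⟨ +-monoˡ-≤ n (s≤s (+-monoˡ-≤ n (m≤n+m∸n m n))) ⟩
  suc (n + (m ∸ n) + n) + n  ≤⟨ +-monoˡ-≤ n (+-monoˡ-≤ (n + (m ∸ n) + n) 1≤n) ⟩
  n + (n + (m ∸ n) + n) + n  ≡⟨ regroup n (m ∸ n) ⟩
  m ∸ n + (2 * n + 2 * n)    ∎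
  where
  open ≤-Reasoning
  regroup : ∀ n a → n + (n + a + n) + n ≡ a + (2 * n + 2 * n)
  regroup = solve-∀

x∉p-x : ∀ {n} (p : Subset n) x → x ∉ p - x
x∉p-x (inside  ∷ p) zero    ()
x∉p-x (outside ∷ p) zero    ()
x∉p-x (_       ∷ p) (suc x) (there x∈p-x) = x∉p-x p x x∈p-x

module _ {n} {p : Subset n} {x y : Fin n} where

  x∈p-y⇒x∈p : x ∈ p - y → x ∈ p
  x∈p-y⇒x∈p = p─q⊆p _ _

  x∈p-y⇒x≢y : x ∈ p - y → x ≢ y
  x∈p-y⇒x≢y x∈p-x refl = x∉p-x p x x∈p-x

x∈p⇒x≡y⊎x∈p-y : ∀ {n} {p : Subset n} {x} y → x ∈ p → x ≡ y ⊎ x ∈ p - y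
x∈p⇒x≡y⊎x∈p-y {x = x} y x∈p with x ≟ y
... | yes x≡y = inj₁ x≡y
... | no x≢y = inj₂ (x∈p∧x≢y⇒x∈p-y x∈p x≢y)

module _ {n} {G : Graph n} where

  _++ʷ_ : ∀ {a b c l m} → Walk G a b l → Walk G b c m → Walk G a c (l + m)
  here     ++ʷ q = q
  step e p ++ʷ q = step e (p ++ʷ q)

  reverseʷ : ∀ {a b l} → Walk G a b l → Walk G b a l
  reverseʷ here = here
  reverseʷ (step {ℓ = l} e p) =
    subst (Walk G _ _) (+-comm l 1) (reverseʷ p ++ʷ step (sym G e) here)

  splitʷ : ∀ {a b l} i → i ≤ l → Walk G a b l → ∃ λ x → Walk G a x i × Walk G x b (l ∸ i)
  splitʷ zero    _         p          = _ , here , p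
  splitʷ (suc i) (s≤s i≤l) (step e p) with splitʷ i i≤l p
  ... | x , p₁ , p₂ = x , step e p₁ , p₂

walk? : ∀ {n} (G : Graph n) l u v → Dec (Walk G u v l)
walk? G zero    u v = map′ (λ { refl → here }) (λ { here → refl }) (u ≟ v)
walk? G (suc l) u v =
  map′ (λ { (w , e , p) → step e p }) (λ { (step e p) → _ , e , p })
       (Fin.any? λ w → adj? G u w ×-dec walk? G l w v)

Near : ℕ → ℕ → ℕ → Set
Near k a b = a ≤ b + k × b ≤ a + k

module _ {n} {G : Graph n} {u : Fin n} where

  shortest-walk : Connected G → ∀ v → ∃ (IsDist G u v)
  shortest-walk conn v = least (λ l → walk? G l u v) (proj₂ (conn u v))

  dist-≤-+ : ∀ {a b da db l} → IsDist G u a da → IsDist G u b db → Walk G a b l → db ≤ da + l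
  dist-≤-+ (p , _) (_ , shortest) q = shortest _ (p ++ʷ q)

  dist-near : ∀ {a b da db l k} → IsDist G u a da → IsDist G u b db →
              l ≤ k → Walk G a b l → Near k da db
  dist-near {da = da} {db} a-dist b-dist l≤k p =
    ≤-trans (dist-≤-+ b-dist a-dist (reverseʷ p)) (+-monoʳ-≤ db l≤k) ,
    ≤-trans (dist-≤-+ a-dist b-dist p) (+-monoʳ-≤ da l≤k)

  geodesic-vertex : ∀ {v D i} → IsDist G u v D → i ≤ D → ∃ λ x → IsDist G u x i
  geodesic-vertex {D = D} {i} (p , shortest) i≤D with splitʷ i i≤D p
  ... | x , p₁ , p₂ = x , p₁ , λ l q → +-cancelʳ-≤ (D ∸ i) i l (begin
    i + (D ∸ i)  ≡⟨ m+[n∸m]≡n i≤D ⟩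
    D            ≤⟨ shortest _ (q ++ʷ p₂) ⟩
    l + (D ∸ i)  ∎)
    where open ≤-Reasoning

module Levels {n} (k : ℕ) (f : Fin n → ℕ) where

  Paired : Subset n → Set
  Paired S = ∀ {s} → s ∈ S → ∃ λ t → t ∈ S - s × Near k (f s) (f t)

  Covers : Subset n → ℕ → Set
  Covers S h = ∀ {i} → i < h → ∃ λ s → s ∈ S × Near k (f s) i

  covers-≤ : ∀ {S h M} → Covers S h → (∀ {z} → z ∈ S → f z ≤ M) → h ≤ suc (M + k)
  covers-≤ {h = zero}  _  _     = z≤n
  covers-≤ {h = suc h} cv ≤M with cv (n<1+n h)
  ... | _ , s∈S , _ , h≤s+k = s≤s (≤-trans h≤s+k (+-monoˡ-≤ k (≤M s∈S)))

  record TopTwo (S : Subset n) : Set where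
    field
      x y   : Fin n
      x∈S   : x ∈ S
      y∈S-x : y ∈ S - x
      x-max : ∀ {z} → z ∈ S → f z ≤ f x
      y-max : ∀ {z} → z ∈ S - x → f z ≤ f y
      x≤y+k : f x ≤ f y + k

    y≤x : f y ≤ f x
    y≤x = x-max (x∈p-y⇒x∈p y∈S-x)

    near-x⇒near-y : ∀ {z} → z ∈ S - x → Near k (f z) (f x) → Near k (f z) (f y)
    near-x⇒near-y z∈S-x zx = ≤-trans (y-max z∈S-x) (m≤m+n (f y) k) , ≤-trans y≤x (proj₂ zx)

  topTwo : ∀ {S s} → Paired S → s ∈ S → TopTwo S
  topTwo {S} paired s∈S with argmax f (_∈? S) (_ , s∈S)
  ... | x , x∈S , x-max with paired x∈S
  ...   | t , t∈S-x , xt with argmax f (_∈? S - x) (t , t∈S-x)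
  ...     | y , y∈S-x , y-max = record
    { x∈S = x∈S ; y∈S-x = y∈S-x ; x-max = x-max ; y-max = y-max
    ; x≤y+k = ≤-trans (proj₁ xt) (+-monoˡ-≤ k (y-max t∈S-x)) }

  module _ {S} (T : TopTwo S) where
    open TopTwo T

    YPartnered : Set
    YPartnered = ∃ λ w → w ∈ S - x - y × Near k (f y) (f w)

    paired-without-x : Paired S → YPartnered → Paired (S - x)
    paired-without-x paired (w , w∈ , yw) {z} z∈S-x with paired (x∈p-y⇒x∈p z∈S-x)
    ... | t , t∈S-z , zt with x∈p⇒x≡y⊎x∈p-y x (x∈p-y⇒x∈p t∈S-z)
    ...   | inj₂ t∈S-x = t , x∈p∧x≢y⇒x∈p-y t∈S-x (x∈p-y⇒x≢y t∈S-z) , zt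
    ...   | inj₁ refl with z ≟ y
    ...     | yes refl = w , w∈ , yw
    ...     | no z≢y = y , x∈p∧x≢y⇒x∈p-y y∈S-x (z≢y ∘ ≡.sym) , near-x⇒near-y z∈S-x zt

    paired-without-x-y : Paired S → ¬ YPartnered → Paired (S - x - y)
    paired-without-x-y paired ¬y-partnered {z} z∈ with paired (x∈p-y⇒x∈p (x∈p-y⇒x∈p z∈))
    ... | t , t∈S-z , zt with x∈p⇒x≡y⊎x∈p-y x (x∈p-y⇒x∈p t∈S-z)
    ...   | inj₁ refl = contradiction (z , z∈ , swap (near-x⇒near-y (x∈p-y⇒x∈p z∈) zt)) ¬y-partnered
    ...   | inj₂ t∈S-x with x∈p⇒x≡y⊎x∈p-y y t∈S-x
    ...     | inj₁ refl = contradiction (z , z∈ , swap zt) ¬y-partnered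
    ...     | inj₂ t∈S-x-y = t , x∈p∧x≢y⇒x∈p-y t∈S-x-y (x∈p-y⇒x≢y t∈S-z) , zt

    covers-without-x : ∀ {h} → Covers S h → Covers (S - x) (h ⊓ suc (f y + k))
    covers-without-x cv {i} i< with cv (m<n⊓o⇒m<n _ _ i<)
    ... | s , s∈S , si with x∈p⇒x≡y⊎x∈p-y x s∈S
    ...   | inj₁ refl = y , y∈S-x , ≤-trans y≤x (proj₁ si) , s≤s⁻¹ (m<n⊓o⇒m<o _ _ i<)
    ...   | inj₂ s∈S-x = s , s∈S-x , si

    below-y∸k⇒¬near : ∀ {i s} → i < f y ∸ k → f y ≤ f s → ¬ Near k (f s) i
    below-y∸k⇒¬near i<y∸k y≤s (s≤i+k , _) = <⇒≱ (m<n∸o⇒m+o<n i<y∸k) (≤-trans y≤s s≤i+k)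

    covers-without-x-y : ∀ {h} → Covers S h → Covers (S - x - y) (h ⊓ (f y ∸ k))
    covers-without-x-y cv {i} i< with cv (m<n⊓o⇒m<n _ _ i<)
    ... | s , s∈S , si with x∈p⇒x≡y⊎x∈p-y x s∈S
    ...   | inj₁ refl = contradiction si (below-y∸k⇒¬near (m<n⊓o⇒m<o _ _ i<) y≤x)
    ...   | inj₂ s∈S-x with x∈p⇒x≡y⊎x∈p-y y s∈S-x
    ...     | inj₁ refl = contradiction si (below-y∸k⇒¬near (m<n⊓o⇒m<o _ _ i<) ≤-refl)
    ...     | inj₂ s∈S-x-y = s , s∈S-x-y , si

  covers-≤-2k*∣S∣ : 1 ≤ k → ∀ {S h} → Acc _⊂_ S → Paired S → Covers S h → h ≤ 2 * k * ∣ S ∣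
  covers-≤-2k*∣S∣ _   {h = zero}    _         _      _  = z≤n
  covers-≤-2k*∣S∣ 1≤k {S} {suc h} (acc smaller) paired cv =
    by-cases (Fin.any? λ w → (w ∈? S - x - y) ×-dec near? (f y) (f w))
    where
    T : TopTwo S
    T = topTwo paired (proj₁ (proj₂ (cv (n<1+n h))))
    open TopTwo T

    near? : ∀ a b → Dec (Near k a b)
    near? a b = (a ≤? b + k) ×-dec (b ≤? a + k)

    IH : ∀ {S′ h′} → S′ ⊂ S → Paired S′ → Covers S′ h′ → h′ ≤ 2 * k * ∣ S′ ∣
    IH S′⊂S = covers-≤-2k*∣S∣ 1≤k (smaller S′⊂S)

    h≤fy+2k+1 : suc h ≤ suc (f y + k) + k
    h≤fy+2k+1 = ≤-trans (covers-≤ cv x-max) (s≤s (+-monoˡ-≤ k x≤y+k))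

    x-costs-2k : 2 * k * ∣ S - x ∣ + 2 * k ≤ 2 * k * ∣ S ∣
    x-costs-2k = m<n⇒o*m+o≤o*n (2 * k) (x∈p⇒∣p-x∣<∣p∣ x∈S)

    open ≤-Reasoning

    x-y-cost-4k : 2 * k * ∣ S - x - y ∣ + (2 * k + 2 * k) ≤ 2 * k * ∣ S ∣
    x-y-cost-4k = begin
      2 * k * ∣ S - x - y ∣ + (2 * k + 2 * k)  ≡⟨ +-assoc (2 * k * ∣ S - x - y ∣) (2 * k) (2 * k) ⟨
      2 * k * ∣ S - x - y ∣ + 2 * k + 2 * k    ≤⟨ +-monoˡ-≤ (2 * k) (m<n⇒o*m+o≤o*n (2 * k) (x∈p⇒∣p-x∣<∣p∣ y∈S-x)) ⟩
      2 * k * ∣ S - x ∣ + 2 * k                ≤⟨ x-costs-2k ⟩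
      2 * k * ∣ S ∣                            ∎

    by-cases : Dec (YPartnered T) → suc h ≤ 2 * k * ∣ S ∣
    by-cases (yes y-partnered) = begin
      suc h                      ≤⟨ m≤n+o⇒m≤m⊓n+o (suc (f y + k)) k h≤fy+2k+1 ⟩
      suc h ⊓ suc (f y + k) + k  ≤⟨ +-monoˡ-≤ k (IH (x∈p⇒p-x⊂p x∈S)
                                      (paired-without-x T paired y-partnered) (covers-without-x T cv)) ⟩
      2 * k * ∣ S - x ∣ + k      ≤⟨ +-monoʳ-≤ (2 * k * ∣ S - x ∣) (m≤m+n k (k + 0)) ⟩
      2 * k * ∣ S - x ∣ + 2 * k  ≤⟨ x-costs-2k ⟩
      2 * k * ∣ S ∣              ∎
    by-cases (no ¬y-partnered) = begin
      suc h                                    ≤⟨ m≤n+o⇒m≤m⊓n+o (f y ∸ k) (2 * k + 2 * k)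
                                                    (≤-trans h≤fy+2k+1 (1+[m+n]+n≤m∸n+[2n+2n] 1≤k (f y))) ⟩
      suc h ⊓ (f y ∸ k) + (2 * k + 2 * k)      ≤⟨ +-monoˡ-≤ (2 * k + 2 * k)
                                                    (IH (⊂-trans (x∈p⇒p-x⊂p y∈S-x) (x∈p⇒p-x⊂p x∈S))
                                                        (paired-without-x-y T paired ¬y-partnered)
                                                        (covers-without-x-y T cv)) ⟩
      2 * k * ∣ S - x - y ∣ + (2 * k + 2 * k)  ≤⟨ x-y-cost-4k ⟩
      2 * k * ∣ S ∣                            ∎

theorem3p3 : (k n : ℕ) → 1 ≤ k → 2 ≤ n → (G : Graph n) → Connected G →
    (D γ : ℕ) → IsDiam G D → IsTotalKDomNumber G k γ →
    D + 1 ≤ 2 * k * γ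
theorem3p3 k n 1≤k _ G conn D γ ((u , v , u-v-dist) , _) ((S , dominating , ∣S∣≡γ) , _) = begin
  D + 1          ≡⟨ +-comm D 1 ⟩
  suc D          ≤⟨ covers-≤-2k*∣S∣ 1≤k (⊂-wellFounded S) paired covers ⟩
  2 * k * ∣ S ∣  ≡⟨ cong (2 * k *_) ∣S∣≡γ ⟩
  2 * k * γ      ∎
  where
  open ≤-Reasoning
  dist : ∀ s → ∃ (IsDist G u s)
  dist = shortest-walk conn
  open Levels k (proj₁ ∘ dist)

  paired : Paired S
  paired {s} _ with dominating s
  ... | w , w∈S , w≢s , _ , l≤k , p =
    w , x∈p∧x≢y⇒x∈p-y w∈S w≢s , dist-near (proj₂ (dist s)) (proj₂ (dist w)) l≤k p

  covers : Covers S (suc D)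
  covers i<1+D with geodesic-vertex u-v-dist (s≤s⁻¹ i<1+D)
  ... | x , x-dist with dominating x
  ...   | w , w∈S , _ , _ , l≤k , p = w , w∈S , swap (dist-near x-dist (proj₂ (dist w)) l≤k p)
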